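{- Let $\nu$ be a partition, $\alpha$ a composition of $|\nu|$, $G\in Tab(\nu,\alpha)$, and $R_\alpha$ a ribbon. Then: (a) $\varphi_{R_\alpha}(G)$ is a Littlewood–Richardson tableau if and only if, whenever two consecutive rows $j$ and $j+1$ of $R_\alpha$ overlap, $\sum_{k=1}^j\alpha_k$ belongs to the descent set of $\widehat G$; (b) if $R_\alpha$ is connected, $\varphi_{R_\alpha}(G)$ is a Littlewood–Richardson tableau if and only if the descent set of $\widehat G$ equals $\mathcal{S}(\alpha)$; (c) if $R_\alpha=\bigoplus_{i=1}^kR_{\tilde\alpha_i}$ is a direct sum of $k$ connected ribbons, where $\alpha$ is the concatenation $\tilde\alpha_1\cdots\tilde\alpha_k$, then $\varphi_{R_\alpha}(G)$ is a Littlewood–Richardson tableau if and only if $\mathcal{S}(\alpha)\setminus\{\sum_{i=1}^r|\tilde\alpha_i|:1\le r\le k\}$ is contained in the descent set of $\widehat G$.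
   Context: SSYT, $Tab(\nu,\alpha)$ (SSYT of shape $\nu$ and content $\alpha$), SYT as usual. The standardization $\widehat G$ of $G$ relabels boxes $1,\dots,|\nu|$ in increasing order of entries, equal entries ordered left to right. The descent set of an SYT $U$ is the set of $i$ such that $i+1$ lies in a row strictly below $i$. $\mathcal{S}(\alpha)=\{\alpha_1,\alpha_1+\alpha_2,\dots,\alpha_1+\dots+\alpha_{\ell(\alpha)-1}\}$. A ribbon is a skew Young diagram containing no $2\times2$ square; $R_\alpha$ denotes a ribbon with rows from top to bottom of lengths $\alpha_1,\dots,\alpha_{\ell(\alpha)}$, consecutive rows sharing at most one column (they "overlap" if they share one) and non-consecutive rows sharing none; it is connected if all consecutive rows overlap; a direct sum of ribbons places them so that they share no edge. For $G\in Tab(\nu,\alpha)$ let $\chi^i_j$ be the number of entries $j$ in row $i$ of $G$. $\varphi_{R_\alpha}(G)$ is the filling of $R_\alpha$ in which row $j$ of $R_\alpha$ contains, for each $i$, $\chi^i_j$ letters $i$, arranged weakly increasing from left to right; its rows are weakly increasing and its reading word (rows read right to left, top to bottom) is a Yamanouchi word of content $\nu$. A Littlewood–Richardson tableau is a skew semistandard tableau (rows weakly increasing, columns strictly increasing) whose reading word is Yamanouchi (every prefix contains at least as many $i$'s as $(i+1)$'s for all $i$). -}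

module Defs where

open import Data.Nat using (ℕ; zero; suc; _+_; _∸_; _≤_; _<_; _≥_; _≟_; _<ᵇ_; _≡ᵇ_)
open import Data.Bool using (Bool; _∨_; _∧_)
open import Data.List using (List; []; _∷_; length; map; concat; take; reverse; replicate; upTo; filter; filterᵇ)
open import Data.Nat.ListAction using (sum)
open import Data.List.Relation.Unary.All using (All)
open import Data.List.Relation.Unary.Linked using (Linked)
open import Data.Product using (_×_; _,_; proj₁; proj₂; ∃; ∃-syntax)
open import Relation.Binary.PropositionalEquality using (_≡_; _≢_)
open import Relation.Nullary using (¬_)

-- Conventions: lists are 0-indexed internally.  Row r (0-indexed) of a
-- tableau is the paper's row r+1; entries/letters are the paper's
-- (1-indexed) values.  Column c is 0-indexed.

_!_ : List ℕ → ℕ → ℕ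
[] ! _ = 0
(x ∷ _) ! zero = x
(_ ∷ xs) ! suc n = xs ! n

row : List (List ℕ) → ℕ → List ℕ
row [] _ = []
row (r ∷ _) zero = r
row (_ ∷ rs) (suc n) = row rs n

count : ℕ → List ℕ → ℕ
count j xs = length (filter (λ x → x ≟ j) xs)

IsPartition : List ℕ → Set
IsPartition ν = All (λ x → 0 < x) ν × Linked _≥_ ν

IsComposition : List ℕ → ℕ → Set
IsComposition α n = All (λ x → 0 < x) α × sum α ≡ n

-- Tableaux (given as the list of their rows, top to bottom)

InShape : List (List ℕ) → ℕ → ℕ → Set
InShape G r c = c < length (row G r)

entry : List (List ℕ) → ℕ → ℕ → ℕ
entry G r c = row G r ! c

IsSSYT : List (List ℕ) → Set
IsSSYT G = All (Linked _≤_) G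
         × (∀ r c → InShape G (suc r) c → entry G r c < entry G (suc r) c)

countT : ℕ → List (List ℕ) → ℕ
countT v G = sum (map (count v) G)

Tab : List ℕ → List ℕ → List (List ℕ) → Set
Tab ν α G = map length G ≡ ν
          × IsSSYT G
          × (∀ r c → InShape G r c → 1 ≤ entry G r c × entry G r c ≤ length α)
          × (∀ j → j < length α → countT (suc j) G ≡ α ! j)

cellsOf : List (List ℕ) → List (ℕ × ℕ)
cellsOf G = concat (map (λ r → map (λ c → r , c) (upTo (length (row G r)))) (upTo (length G)))

before : ℕ × ℕ → ℕ × ℕ → Bool
before (v , c) (v' , c') = (v <ᵇ v') ∨ ((v ≡ᵇ v') ∧ (c <ᵇ c'))

stdEntry : List (List ℕ) → ℕ → ℕ → ℕ
stdEntry G r c =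
  suc (length (filterᵇ (λ p → before (entry G (proj₁ p) (proj₂ p) , proj₂ p) (entry G r c , c)) (cellsOf G)))

standardize : List (List ℕ) → List (List ℕ)
standardize G = map (λ r → map (λ c → stdEntry G r c) (upTo (length (row G r)))) (upTo (length G))

Descent : List (List ℕ) → ℕ → Set
Descent U i = ∃[ r ] ∃[ c ] ∃[ r' ] ∃[ c' ]
  (InShape U r c × InShape U r' c' × entry U r c ≡ i × entry U r' c' ≡ suc i × r < r')

InS : List ℕ → ℕ → Set
InS α i = ∃[ j ] (suc j < length α × i ≡ sum (take (suc j) α))

-- Ribbons.  R_α is given by α and the list s of starting columns of
-- its rows (top to bottom): row j occupies columns s_j, …, s_j+α_j-1.

InRibbon : List ℕ → List ℕ → ℕ → ℕ → Set
InRibbon α s j c = s ! j ≤ c × c < s ! j + α ! j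

-- skew Young diagram (λ/μ with μ_j = s_j, λ_j = s_j + α_j weakly
-- decreasing) containing no 2×2 square
IsRibbon : List ℕ → List ℕ → Set
IsRibbon α s = length s ≡ length α
  × (∀ j → suc j < length α → s ! suc j ≤ s ! j × s ! suc j + α ! suc j ≤ s ! j + α ! j)
  × (∀ j c → ¬ (InRibbon α s j c × InRibbon α s j (suc c)
               × InRibbon α s (suc j) c × InRibbon α s (suc j) (suc c)))

Overlap : List ℕ → List ℕ → ℕ → Set
Overlap α s j = ∃[ c ] (InRibbon α s j c × InRibbon α s (suc j) c)

Connected : List ℕ → List ℕ → Set
Connected α s = ∀ j → suc j < length α → Overlap α s j

-- φ_{R_α}(G): row j (0-indexed, i.e. paper row j+1) contains χ^i_{j+1}
-- letters i for each row i of G, weakly increasing.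

phiRow : List (List ℕ) → ℕ → List ℕ
phiRow G j = concat (map (λ i → replicate (count (suc j) (row G i)) (suc i)) (upTo (length G)))

phi : List (List ℕ) → List ℕ → List (List ℕ)
phi G α = map (phiRow G) (upTo (length α))

fillEntry : List (List ℕ) → List ℕ → ℕ → ℕ → ℕ
fillEntry F s j c = row F j ! (c ∸ s ! j)

readingWord : List (List ℕ) → List ℕ
readingWord F = concat (map reverse F)

Yamanouchi : List ℕ → Set
Yamanouchi w = ∀ k i → count (suc (suc i)) (take k w) ≤ count (suc i) (take k w)

IsLR : List ℕ → List ℕ → List (List ℕ) → Set
IsLR α s F = map length F ≡ α
  × All (Linked _≤_) F
  × (∀ j j' c → j < j' → InRibbon α s j c → InRibbon α s j' c → fillEntry F s j c < fillEntry F s j' c)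
  × Yamanouchi (readingWord F)

-- Direct sums: blocks αs with α = concatenation of αs

RowBoundary : List (List ℕ) → ℕ → Set
RowBoundary αs m = ∃[ r ] (r < length αs × m ≡ sum (take (suc r) (map length αs)))

BlockSums : List (List ℕ) → ℕ → Set
BlockSums αs i = ∃[ r ] (r < length αs × i ≡ sum (take (suc r) (map sum αs)))

-- Proposition 3.10.  Write N_m = α₁+…+α_m; G has a letter descent at m
-- (Descent G m, read on G itself) if an entry m lies strictly above an m+1.
--  (1) Standardization: a cell with entry v has rank (number of preceding
--      cells) in [N_{v-1}, N_v).  So Ĝ descends at N_m iff G has a letter
--      descent at m (look at the rightmost m and the leftmost m+1), and every
--      descent of Ĝ is such an N_m, i.e. lies in 𝒮(α).
--  (2) Row j of φ(G) is the sorted word with χ^i_j letters i; its reading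
--      word is Yamanouchi since, by column strictness, row i+1 of G has no
--      more entries ≤ j+1 than row i has entries ≤ j.
--  (3) Overlapping ribbon rows j, j+1 share only the first column of row j,
--      the last of row j+1; there φ(G) shows 1 + the highest row of G holding
--      j and 1 + the lowest holding j+1, so that column is strict iff G has a
--      letter descent at j, and then all ribbon columns are strict.
-- After list and counting lemmas come (3) for any filling of a ribbon, then
-- (1), (2) for a fixed tableau; (a) combines them and (b), (c) follow from
-- (a), (1) and injectivity of the partial sums of α.

module Submission where

open import Defs
open import Data.Nat using (ℕ; zero; suc; _+_; _∸_; _≤_; _<_; _≥_; _≟_; _≤?_; _<?_; _<ᵇ_; _≡ᵇ_; s≤s; z≤n; _≤′_; ≤′-refl; ≤′-step)
open import Data.Nat.Properties
open import Data.Nat.ListAction using (sum)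
open import Data.Nat.ListAction.Properties using (sum-++)
open import Data.List using (List; []; _∷_; _++_; applyUpTo; concat; filter; filterᵇ; length; map; replicate; reverse; take; upTo)
open import Data.List.Properties using (map-∘; ++-identityʳ; applyUpTo-∷ʳ; filter-++; length-++; length-applyUpTo; length-replicate; map-applyUpTo; map-upTo; take-[]; unfold-reverse; filter-accept; filter-reject)
open import Data.List.Relation.Unary.All as All using (All; []; _∷_)
import Data.List.Relation.Unary.All.Properties as AllP
open import Data.List.Relation.Unary.Any using (here; there)
open import Data.List.Relation.Unary.Linked as Linked using (Linked; [-]; []; _∷_)
open import Data.List.Relation.Unary.Linked.Properties using (Linked⇒All)
open import Data.List.Membership.Propositional using (_∈_)
open import Data.List.Membership.Propositional.Properties using (∈-++⁻; ∈-filter⁺; ∈-filter⁻; ∈-concat⁺′; ∈-concat⁻′; ∈-map⁺; ∈-map⁻; ∈-upTo⁺; ∈-upTo⁻)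
open import Data.List.Extrema.Nat using (argmax; argmin; argmax-all; argmin-all; f[xs]≤f[argmax]; f[argmin]≤f[xs])
open import Relation.Unary using (Decidable)
open import Data.Product using (_,_; _×_; proj₁; proj₂; ∃-syntax)
open import Data.Sum using (_⊎_; inj₁; inj₂; [_,_])
open import Data.Empty using (⊥; ⊥-elim)
open import Data.Bool using (Bool; T; true; false; _∨_)
open import Data.Bool.Properties using (T-∨; T-∧)
open import Function using (_∘_)
open import Function.Bundles using (Equivalence; _⇔_; mk⇔)
open import Data.List.Relation.Unary.Unique.Propositional using (Unique)
open import Data.List.Relation.Unary.AllPairs using ([]; _∷_)
import Data.List.Relation.Unary.Unique.Propositional.Properties as UP
open import Relation.Binary.PropositionalEquality hiding ([_])
open import Relation.Nullary using (¬_; Dec; yes; no)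
open import Relation.Nullary.Decidable using (T?)
open import Relation.Binary.Definitions using (tri<; tri≈; tri>)

!-outside : ∀ xs k → length xs ≤ k → xs ! k ≡ 0
!-outside [] k _ = refl
!-outside (x ∷ xs) (suc k) (s≤s h) = !-outside xs k h

!-∈ : ∀ xs k → k < length xs → (xs ! k) ∈ xs
!-∈ (x ∷ xs) zero _ = here refl
!-∈ (x ∷ xs) (suc k) (s≤s h) = there (!-∈ xs k h)

row-outside : ∀ G r → length G ≤ r → row G r ≡ []
row-outside [] r _ = refl
row-outside (x ∷ G) (suc r) (s≤s h) = row-outside G r h

row-All : ∀ {P : List ℕ → Set} G r → All P G → P [] → P (row G r)
row-All [] r _ p = p
row-All (x ∷ G) zero (px ∷ _) _ = px
row-All (x ∷ G) (suc r) (_ ∷ a) p = row-All G r a p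

length-row : ∀ G r → length (row G r) ≡ map length G ! r
length-row [] r = refl
length-row (x ∷ G) zero = refl
length-row (x ∷ G) (suc r) = length-row G r

applyUpTo-cong : ∀ {A : Set} {f g : ℕ → A} n → (∀ i → f i ≡ g i) → applyUpTo f n ≡ applyUpTo g n
applyUpTo-cong zero h = refl
applyUpTo-cong (suc n) h = cong₂ _∷_ (h 0) (applyUpTo-cong n (λ i → h (suc i)))

row-applyUpTo : ∀ (F : ℕ → List ℕ) n r → r < n → row (applyUpTo F n) r ≡ F r
row-applyUpTo F (suc n) zero _ = refl
row-applyUpTo F (suc n) (suc r) (s≤s h) = row-applyUpTo (λ i → F (suc i)) n r h

row-tabulate : ∀ (F : ℕ → List ℕ) n r → r < n → row (map F (upTo n)) r ≡ F r
row-tabulate F n r h rewrite map-upTo F n = row-applyUpTo F n r h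

!-applyUpTo : ∀ (f : ℕ → ℕ) n r → r < n → applyUpTo f n ! r ≡ f r
!-applyUpTo f (suc n) zero _ = refl
!-applyUpTo f (suc n) (suc r) (s≤s h) = !-applyUpTo (λ i → f (suc i)) n r h

!-tabulate : ∀ (f : ℕ → ℕ) n r → r < n → map f (upTo n) ! r ≡ f r
!-tabulate f n r h rewrite map-upTo f n = !-applyUpTo f n r h

length-tabulate : ∀ {A : Set} (F : ℕ → A) n → length (map F (upTo n)) ≡ n
length-tabulate F n rewrite map-upTo F n = length-applyUpTo F n

applyUpTo-! : ∀ (f : ℕ → ℕ) α → (∀ j → j < length α → f j ≡ α ! j) → applyUpTo f (length α) ≡ α
applyUpTo-! f [] h = refl
applyUpTo-! f (a ∷ α) h = cong₂ _∷_ (h 0 (s≤s z≤n)) (applyUpTo-! (λ i → f (suc i)) α (λ j jl → h (suc j) (s≤s jl)))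

applyUpTo-row : ∀ (f : List ℕ → ℕ) G → applyUpTo (λ r → f (row G r)) (length G) ≡ map f G
applyUpTo-row f [] = refl
applyUpTo-row f (y ∷ G) = cong (f y ∷_) (applyUpTo-row f G)

take-applyUpTo : ∀ {A : Set} (f : ℕ → A) m n → m ≤ n → take m (applyUpTo f n) ≡ applyUpTo f m
take-applyUpTo f zero n _ = refl
take-applyUpTo f (suc m) (suc n) (s≤s h) = cong (f 0 ∷_) (take-applyUpTo (λ i → f (suc i)) m n h)

All-! : ∀ {P : ℕ → Set} xs → (∀ c → c < length xs → P (xs ! c)) → All P xs
All-! [] h = []
All-! (x ∷ xs) h = h 0 (s≤s z≤n) ∷ All-! xs (λ c cl → h (suc c) (s≤s cl))

take-++-≤ : ∀ {A : Set} k (xs ys : List A) → k ≤ length xs → take k (xs ++ ys) ≡ take k xs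
take-++-≤ zero xs ys _ = refl
take-++-≤ (suc k) (x ∷ xs) ys (s≤s h) = cong (x ∷_) (take-++-≤ k xs ys h)

take-++-≥ : ∀ {A : Set} k (xs ys : List A) → length xs ≤ k → take k (xs ++ ys) ≡ xs ++ take (k ∸ length xs) ys
take-++-≥ k [] ys _ = refl
take-++-≥ (suc k) (x ∷ xs) ys (s≤s h) = cong (x ∷_) (take-++-≥ k xs ys h)

positive-! : ∀ α j → All (0 <_) α → j < length α → 0 < α ! j
positive-! (a ∷ α) zero (p ∷ _) _ = p
positive-! (a ∷ α) (suc j) (_ ∷ ps) (s≤s h) = positive-! α j ps h

sum-take-suc : ∀ α m → m < length α → sum (take (suc m) α) ≡ sum (take m α) + α ! m
sum-take-suc (a ∷ α) zero _ = +-identityʳ a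
sum-take-suc (a ∷ α) (suc m) (s≤s h) = trans (cong (a +_) (sum-take-suc α m h)) (sym (+-assoc a _ _))

partialSum-< : ∀ α m m' → All (0 <_) α → m < m' → m' ≤ length α → sum (take m α) < sum (take m' α)
partialSum-< (a ∷ α) zero (suc m') (p ∷ _) _ _ = <-≤-trans p (m≤m+n a _)
partialSum-< (a ∷ α) (suc m) (suc m') (_ ∷ ps) (s≤s h) (s≤s l) = +-monoʳ-< a (partialSum-< α m m' ps h l)

partialSum-injective : ∀ α m m' → All (0 <_) α → m ≤ length α → m' ≤ length α
  → sum (take m α) ≡ sum (take m' α) → m ≡ m'
partialSum-injective α m m' ps l l' e with <-cmp m m'
... | tri≈ _ x _ = x
... | tri< x _ _ = ⊥-elim (<-irrefl e (partialSum-< α m m' ps x l'))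
... | tri> _ _ x = ⊥-elim (<-irrefl (sym e) (partialSum-< α m' m ps x l))

linked-lowerBound : ∀ {x} xs → Linked _≤_ (x ∷ xs) → All (x ≤_) xs
linked-lowerBound xs l = All.tail (Linked⇒All ≤-trans ≤-refl l)

linked-mono : ∀ xs c c' → Linked _≤_ xs → c ≤ c' → c' < length xs → xs ! c ≤ xs ! c'
linked-mono (x ∷ xs) zero zero l _ _ = ≤-refl
linked-mono (x ∷ xs) zero (suc c') l _ (s≤s h) = All.lookup (linked-lowerBound xs l) (!-∈ xs c' h)
linked-mono (x ∷ xs) (suc c) (suc c') l (s≤s cc) (s≤s h) = linked-mono xs c c' (Linked.tail l) cc h

linked-replicate : ∀ n a ys → Linked _≤_ ys → All (a ≤_) ys → Linked _≤_ (replicate n a ++ ys)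
linked-replicate zero a ys l h = l
linked-replicate (suc n) a ys l h = cons (linked-replicate n a ys l h) (bound n)
  where
    cons : ∀ {zs} → Linked _≤_ zs → All (a ≤_) zs → Linked _≤_ (a ∷ zs)
    cons {[]} _ _ = [-]
    cons {_ ∷ _} l (p ∷ _) = p ∷ l
    bound : ∀ k → All (a ≤_) (replicate k a ++ ys)
    bound zero = h
    bound (suc k) = ≤-refl ∷ bound k

count-++ : ∀ j xs ys → count j (xs ++ ys) ≡ count j xs + count j ys
count-++ j xs ys = trans (cong length (filter-++ (_≟ j) xs ys)) (length-++ (filter (_≟ j) xs))

count-here : ∀ {j x} xs → x ≡ j → count j (x ∷ xs) ≡ suc (count j xs)
count-here {j} xs e = cong length (filter-accept (_≟ j) {xs = xs} e)

count-there : ∀ {j x} xs → x ≢ j → count j (x ∷ xs) ≡ count j xs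
count-there {j} xs x≢j = cong length (filter-reject (_≟ j) {xs = xs} x≢j)

count-concat : ∀ x xss → count x (concat xss) ≡ sum (map (count x) xss)
count-concat x [] = refl
count-concat x (xs ∷ xss) = trans (count-++ x xs (concat xss)) (cong (count x xs +_) (count-concat x xss))

count-reverse : ∀ j xs → count j (reverse xs) ≡ count j xs
count-reverse j [] = refl
count-reverse j (x ∷ xs) = begin
    count j (reverse (x ∷ xs))          ≡⟨ cong (count j) (unfold-reverse x xs) ⟩
    count j (reverse xs ++ x ∷ [])      ≡⟨ count-++ j (reverse xs) (x ∷ []) ⟩
    count j (reverse xs) + count j (x ∷ []) ≡⟨ cong (_+ count j (x ∷ [])) (count-reverse j xs) ⟩
    count j xs + count j (x ∷ [])       ≡⟨ +-comm (count j xs) _ ⟩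
    count j (x ∷ []) + count j xs       ≡⟨ sym (count-++ j (x ∷ []) xs) ⟩
    count j (x ∷ xs)                    ∎
  where open ≡-Reasoning

count-take : ∀ j k xs → count j (take k xs) ≤ count j xs
count-take j zero xs = z≤n
count-take j (suc k) [] = z≤n
count-take j (suc k) (x ∷ xs) with x ≟ j
... | yes e rewrite count-here (take k xs) e | count-here xs e = s≤s (count-take j k xs)
... | no x≢j rewrite count-there (take k xs) x≢j | count-there xs x≢j = count-take j k xs

count-pos : ∀ j xs → 0 < count j xs → ∃[ c ] (c < length xs × xs ! c ≡ j)
count-pos j (x ∷ xs) h with x ≟ j
... | yes e = 0 , s≤s z≤n , e
... | no x≢j rewrite count-there xs x≢j with count-pos j xs h
...   | c , cl , e = suc c , s≤s cl , e

pos-count : ∀ j xs c → c < length xs → xs ! c ≡ j → 0 < count j xs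
pos-count j (x ∷ xs) zero _ e rewrite count-here xs e = s≤s z≤n
pos-count j (x ∷ xs) (suc c) (s≤s cl) e with x ≟ j
... | yes x≡j rewrite count-here xs x≡j = s≤s z≤n
... | no x≢j rewrite count-there xs x≢j = pos-count j xs c cl e

-- Sorted words with prescribed multiplicities.
-- letters k ms is the weakly increasing word with ms ! i copies of the
-- letter k+i+1; each row of φ(G) is such a word.

letters : ℕ → List ℕ → List ℕ
letters k [] = []
letters k (m ∷ ms) = replicate m (suc k) ++ letters (suc k) ms

length-letters : ∀ k ms → length (letters k ms) ≡ sum ms
length-letters k [] = refl
length-letters k (m ∷ ms) = begin
    length (replicate m (suc k) ++ letters (suc k) ms)          ≡⟨ length-++ (replicate m (suc k)) ⟩
    length (replicate m (suc k)) + length (letters (suc k) ms)  ≡⟨ cong₂ _+_ (length-replicate m) (length-letters (suc k) ms) ⟩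
    m + sum ms                                                  ∎
  where open ≡-Reasoning

letters-lowerBound : ∀ k ms → All (suc k ≤_) (letters k ms)
letters-lowerBound k [] = []
letters-lowerBound k (m ∷ ms) = copies m
  where
    copies : ∀ n → All (suc k ≤_) (replicate n (suc k) ++ letters (suc k) ms)
    copies zero = All.map (≤-trans (n≤1+n _)) (letters-lowerBound (suc k) ms)
    copies (suc n) = ≤-refl ∷ copies n

letters-sorted : ∀ k ms → Linked _≤_ (letters k ms)
letters-sorted k [] = []
letters-sorted k (m ∷ ms) = linked-replicate m (suc k) (letters (suc k) ms) (letters-sorted (suc k) ms)
  (All.map (≤-trans (n≤1+n _)) (letters-lowerBound (suc k) ms))

count-replicate-≢ : ∀ n a j → a ≢ j → count j (replicate n a) ≡ 0
count-replicate-≢ zero a j _ = refl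
count-replicate-≢ (suc n) a j a≢j = trans (count-there (replicate n a) a≢j) (count-replicate-≢ n a j a≢j)

count-replicate-≡ : ∀ n j → count j (replicate n j) ≡ n
count-replicate-≡ zero j = refl
count-replicate-≡ (suc n) j = trans (count-here (replicate n j) refl) (cong suc (count-replicate-≡ n j))

count-below-letters : ∀ k ms x → x ≤ k → count x (letters k ms) ≡ 0
count-below-letters k ms x x≤k = absent (letters k ms) (letters-lowerBound k ms)
  where
    absent : ∀ ys → All (suc k ≤_) ys → count x ys ≡ 0
    absent [] _ = refl
    absent (y ∷ ys) (k<y ∷ ks) = trans (count-there ys (λ y≡x → <⇒≱ k<y (subst (_≤ k) (sym y≡x) x≤k))) (absent ys ks)

count-letters : ∀ k ms i → count (suc (k + i)) (letters k ms) ≡ ms ! i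
count-letters k [] i = refl
count-letters k (m ∷ ms) zero rewrite +-identityʳ k =
  begin
    count (suc k) (replicate m (suc k) ++ letters (suc k) ms)          ≡⟨ count-++ (suc k) (replicate m (suc k)) _ ⟩
    count (suc k) (replicate m (suc k)) + count (suc k) (letters (suc k) ms)
      ≡⟨ cong₂ _+_ (count-replicate-≡ m (suc k)) (count-below-letters (suc k) ms (suc k) ≤-refl) ⟩
    m + 0                                                              ≡⟨ +-identityʳ m ⟩
    m                                                                  ∎
  where open ≡-Reasoning
count-letters k (m ∷ ms) (suc i) rewrite +-suc k i =
  begin
    count (suc (suc (k + i))) (replicate m (suc k) ++ letters (suc k) ms)  ≡⟨ count-++ _ (replicate m (suc k)) _ ⟩
    count (suc (suc (k + i))) (replicate m (suc k)) + count (suc (suc k + i)) (letters (suc k) ms)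
      ≡⟨ cong₂ _+_ (count-replicate-≢ m (suc k) _ (λ e → <⇒≢ (s≤s (m≤m+n k i)) (suc-injective e))) (count-letters (suc k) ms i) ⟩
    ms ! i                                                                  ∎
  where open ≡-Reasoning

∈-letters : ∀ {x} k ms → x ∈ letters k ms → ∃[ i ] (x ≡ suc (k + i) × 0 < ms ! i)
∈-letters {x} k (m ∷ ms) x∈ with ∈-++⁻ (replicate m (suc k)) x∈
... | inj₁ x∈copies = 0 , trans (copy x∈copies) (cong suc (sym (+-identityʳ k))) , nonempty m x∈copies
  where
    copy : ∀ {n} → x ∈ replicate n (suc k) → x ≡ suc k
    copy {suc n} (here e) = e
    copy {suc n} (there p) = copy p
    nonempty : ∀ n → x ∈ replicate n (suc k) → 0 < n
    nonempty (suc n) _ = s≤s z≤n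
... | inj₂ x∈rest with ∈-letters (suc k) ms x∈rest
...   | i , e , pos = suc i , trans e (cong suc (sym (+-suc k i))) , pos

atMost : ℕ → List ℕ → ℕ
atMost m xs = length (filter (_≤? m) xs)

atMost-here : ∀ {m x} xs → x ≤ m → atMost m (x ∷ xs) ≡ suc (atMost m xs)
atMost-here {m} xs x≤m = cong length (filter-accept (_≤? m) {xs = xs} x≤m)

atMost-there : ∀ {m x} xs → ¬ x ≤ m → atMost m (x ∷ xs) ≡ atMost m xs
atMost-there {m} xs x≰m = cong length (filter-reject (_≤? m) {xs = xs} x≰m)

atMost-suc : ∀ m xs → atMost (suc m) xs ≡ atMost m xs + count (suc m) xs
atMost-suc m [] = refl
atMost-suc m (x ∷ xs) with x ≤? m | x ≟ suc m
... | yes x≤m | _ rewrite atMost-here xs (m≤n⇒m≤1+n x≤m) | atMost-here xs x≤m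
                        | count-there xs (λ e → <-irrefl e (s≤s x≤m)) = cong suc (atMost-suc m xs)
... | no x≰m | yes e rewrite atMost-here xs (≤-reflexive e) | atMost-there xs x≰m | count-here xs e
  = trans (cong suc (atMost-suc m xs)) (sym (+-suc _ _))
... | no x≰m | no x≢ rewrite atMost-there xs (λ x≤ → x≢ (≤-antisym x≤ (≰⇒> x≰m))) | atMost-there xs x≰m
                           | count-there xs x≢ = atMost-suc m xs

sum-counts : ∀ m xs → All (1 ≤_) xs → sum (applyUpTo (λ k → count (suc k) xs) m) ≡ atMost m xs
sum-counts zero xs pos = sym (none xs pos)
  where
    none : ∀ ys → All (1 ≤_) ys → atMost 0 ys ≡ 0
    none [] _ = refl
    none (y ∷ ys) (p ∷ ps) = trans (atMost-there ys (λ y≤0 → <⇒≱ p y≤0)) (none ys ps)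
sum-counts (suc m) xs pos = begin
    sum (applyUpTo f (suc m))              ≡⟨ cong sum (sym (applyUpTo-∷ʳ f m)) ⟩
    sum (applyUpTo f m ++ f m ∷ [])        ≡⟨ sum-++ (applyUpTo f m) (f m ∷ []) ⟩
    sum (applyUpTo f m) + (f m + 0)        ≡⟨ cong₂ _+_ (sum-counts m xs pos) (+-identityʳ (f m)) ⟩
    atMost m xs + count (suc m) xs         ≡⟨ sym (atMost-suc m xs) ⟩
    atMost (suc m) xs                      ∎
  where
    open ≡-Reasoning
    f : ℕ → ℕ
    f k = count (suc k) xs

atMost-column : ∀ j xs ys → length xs ≤ length ys
  → (∀ c → c < length xs → xs ! c ≤ suc j → ys ! c ≤ j) → atMost (suc j) xs ≤ atMost j ys
atMost-column j [] ys _ _ = z≤n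
atMost-column j (x ∷ xs) (y ∷ ys) (s≤s l) h with x ≤? suc j
... | yes x≤ rewrite atMost-here xs x≤ | atMost-here ys (h 0 (s≤s z≤n) x≤) =
  s≤s (atMost-column j xs ys l (λ c cl → h (suc c) (s≤s cl)))
... | no x≰ rewrite atMost-there xs x≰ = ≤-trans (atMost-column j xs ys l (λ c cl → h (suc c) (s≤s cl))) (grow y ys)
  where
    grow : ∀ z zs → atMost j zs ≤ atMost j (z ∷ zs)
    grow z zs with z ≤? j
    ... | yes z≤ rewrite atMost-here zs z≤ = n≤1+n _
    ... | no z≰ rewrite atMost-there zs z≰ = ≤-refl

-- Within a row the count of b in a prefix of the reading word is at most
-- its count up to the end of that row, while the count of a is at least
-- its count over the earlier rows; so it suffices to compare these.
-- The statement is generalised by the counts p, q accumulated before F.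
yamanouchi-rows-from : ∀ a b (F : List (List ℕ)) p q → q ≤ p
  → (∀ j → j < length F → q + count b (concat (take (suc j) F)) ≤ p + count a (concat (take j F)))
  → ∀ k → q + count b (take k (readingWord F)) ≤ p + count a (take k (readingWord F))
yamanouchi-rows-from a b [] p q q≤p _ k rewrite take-[] {A = ℕ} k = +-monoˡ-≤ 0 q≤p
yamanouchi-rows-from a b (r ∷ F) p q q≤p rows k = split (k ≤? length (reverse r))
  where
    open ≤-Reasoning
    firstRow : q + count b r ≤ p
    firstRow = subst₂ (λ x y → q + count b x ≤ y) (++-identityʳ r) (+-identityʳ p) (rows 0 (s≤s z≤n))
    rows' : ∀ j → j < length F → (q + count b r) + count b (concat (take (suc j) F)) ≤ (p + count a r) + count a (concat (take j F))
    rows' j j< = subst₂ _≤_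
      (trans (cong (q +_) (count-++ b r _)) (sym (+-assoc q _ _)))
      (trans (cong (p +_) (count-++ a r _)) (sym (+-assoc p _ _)))
      (rows (suc j) (s≤s j<))
    afterRow : ∀ x n t → n + count x (reverse r ++ t) ≡ (n + count x r) + count x t
    afterRow x n t = trans (cong (n +_) (trans (count-++ x (reverse r) t) (cong (_+ count x t) (count-reverse x r)))) (sym (+-assoc n _ _))
    split : Dec (k ≤ length (reverse r))
      → q + count b (take k (reverse r ++ readingWord F)) ≤ p + count a (take k (reverse r ++ readingWord F))
    split (yes inRow) rewrite take-++-≤ k (reverse r) (readingWord F) inRow = begin
      q + count b (take k (reverse r))  ≤⟨ +-monoʳ-≤ q (count-take b k (reverse r)) ⟩
      q + count b (reverse r)           ≡⟨ cong (q +_) (count-reverse b r) ⟩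
      q + count b r                     ≤⟨ firstRow ⟩
      p                                 ≤⟨ m≤m+n p _ ⟩
      p + count a (take k (reverse r))  ∎
    split (no pastRow) rewrite take-++-≥ k (reverse r) (readingWord F) (≰⇒≥ pastRow) = begin
      q + count b (reverse r ++ take k' (readingWord F))      ≡⟨ afterRow b q _ ⟩
      (q + count b r) + count b (take k' (readingWord F))     ≤⟨ yamanouchi-rows-from a b F (p + count a r) (q + count b r)
                                                                   (≤-trans firstRow (m≤m+n p _)) rows' k' ⟩
      (p + count a r) + count a (take k' (readingWord F))     ≡⟨ sym (afterRow a p _) ⟩
      p + count a (reverse r ++ take k' (readingWord F))      ∎
      where
        k' : ℕ
        k' = k ∸ length (reverse r)

yamanouchi-rows : ∀ a b (F : List (List ℕ))
  → (∀ j → j < length F → count b (concat (take (suc j) F)) ≤ count a (concat (take j F)))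
  → ∀ k → count b (take k (readingWord F)) ≤ count a (take k (readingWord F))
yamanouchi-rows a b F rows = yamanouchi-rows-from a b F 0 0 z≤n rows

module _ {A : Set} {P : A → Set} (P? : Decidable P) (f : A → ℕ) where

  largest : ∀ {xs a} → a ∈ xs → P a → ∃[ m ] (m ∈ xs × P m × (∀ {q} → q ∈ xs → P q → f q ≤ f m))
  largest {xs} {a} a∈ pa =
    m , proj₁ mP , proj₂ mP ,
    λ q∈ pq → All.lookup (f[xs]≤f[argmax] a (filter P? xs)) (∈-filter⁺ P? q∈ pq)
    where
      m : A
      m = argmax f a (filter P? xs)
      mP : m ∈ xs × P m
      mP = argmax-all f (a∈ , pa) (All.tabulate (∈-filter⁻ P?))

  smallest : ∀ {xs a} → a ∈ xs → P a → ∃[ m ] (m ∈ xs × P m × (∀ {q} → q ∈ xs → P q → f m ≤ f q))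
  smallest {xs} {a} a∈ pa =
    m , proj₁ mP , proj₂ mP ,
    λ q∈ pq → All.lookup (f[argmin]≤f[xs] a (filter P? xs)) (∈-filter⁺ P? q∈ pq)
    where
      m : A
      m = argmin f a (filter P? xs)
      mP : m ∈ xs × P m
      mP = argmin-all f (a∈ , pa) (All.tabulate (∈-filter⁻ P?))

module _ {A : Set} where

  countᵇ : (A → Bool) → List A → ℕ
  countᵇ p xs = length (filterᵇ p xs)

  countᵇ-here : ∀ (p : A → Bool) {x} xs → T (p x) → countᵇ p (x ∷ xs) ≡ suc (countᵇ p xs)
  countᵇ-here p xs px = cong length (filter-accept (T? ∘ p) {xs = xs} px)

  countᵇ-there : ∀ (p : A → Bool) {x} xs → ¬ T (p x) → countᵇ p (x ∷ xs) ≡ countᵇ p xs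
  countᵇ-there p xs ¬px = cong length (filter-reject (T? ∘ p) {xs = xs} ¬px)

  countᵇ-cons : ∀ (p : A → Bool) x xs → countᵇ p xs ≤ countᵇ p (x ∷ xs)
  countᵇ-cons p x xs with T? (p x)
  ... | yes px rewrite countᵇ-here p xs px = n≤1+n _
  ... | no ¬px rewrite countᵇ-there p xs ¬px = ≤-refl

  countᵇ-++ : ∀ (p : A → Bool) xs ys → countᵇ p (xs ++ ys) ≡ countᵇ p xs + countᵇ p ys
  countᵇ-++ p xs ys = trans (cong length (filter-++ (T? ∘ p) xs ys)) (length-++ (filterᵇ p xs))

  countᵇ-concat : ∀ (p : A → Bool) xss → countᵇ p (concat xss) ≡ sum (map (countᵇ p) xss)
  countᵇ-concat p [] = refl
  countᵇ-concat p (xs ∷ xss) = trans (countᵇ-++ p xs (concat xss)) (cong (countᵇ p xs +_) (countᵇ-concat p xss))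

  countᵇ-mono : ∀ (p q : A → Bool) xs → (∀ {a} → a ∈ xs → T (p a) → T (q a)) → countᵇ p xs ≤ countᵇ q xs
  countᵇ-mono p q [] h = z≤n
  countᵇ-mono p q (x ∷ xs) h with T? (p x) | T? (q x)
  ... | yes px | yes qx rewrite countᵇ-here p xs px | countᵇ-here q xs qx = s≤s (countᵇ-mono p q xs (h ∘ there))
  ... | yes px | no ¬qx = ⊥-elim (¬qx (h (here refl) px))
  ... | no ¬px | _ rewrite countᵇ-there p xs ¬px = ≤-trans (countᵇ-mono p q xs (h ∘ there)) (countᵇ-cons q x xs)

  countᵇ-strict : ∀ (p q : A → Bool) xs x → x ∈ xs → T (q x) → ¬ T (p x)
    → (∀ {a} → a ∈ xs → T (p a) → T (q a)) → suc (countᵇ p xs) ≤ countᵇ q xs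
  countᵇ-strict p q (y ∷ xs) x (here refl) qx ¬px h rewrite countᵇ-here q xs qx | countᵇ-there p xs ¬px =
    s≤s (countᵇ-mono p q xs (h ∘ there))
  countᵇ-strict p q (y ∷ xs) x (there x∈) qx ¬px h with T? (p y) | T? (q y)
  ... | yes py | yes qy rewrite countᵇ-here p xs py | countᵇ-here q xs qy = s≤s (countᵇ-strict p q xs x x∈ qx ¬px (h ∘ there))
  ... | yes py | no ¬qy = ⊥-elim (¬qy (h (here refl) py))
  ... | no ¬py | _ rewrite countᵇ-there p xs ¬py = ≤-trans (countᵇ-strict p q xs x x∈ qx ¬px (h ∘ there)) (countᵇ-cons q y xs)

  countᵇ-but-one : ∀ (p q : A → Bool) xs x → Unique xs → (∀ {a} → a ∈ xs → T (p a) → T (q a) ⊎ a ≡ x)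
    → countᵇ p xs ≤ suc (countᵇ q xs)
  countᵇ-but-one p q [] x _ h = z≤n
  countᵇ-but-one p q (y ∷ xs) x (y∉ ∷ u) h with T? (p y)
  ... | no ¬py rewrite countᵇ-there p xs ¬py =
    ≤-trans (countᵇ-but-one p q xs x u (h ∘ there)) (s≤s (countᵇ-cons q y xs))
  ... | yes py with h (here refl) py
  ...   | inj₁ qy rewrite countᵇ-here p xs py | countᵇ-here q xs qy = s≤s (countᵇ-but-one p q xs x u (h ∘ there))
  ...   | inj₂ refl rewrite countᵇ-here p xs py = s≤s (≤-trans (countᵇ-mono p q xs others) (countᵇ-cons q y xs))
    where
      others : ∀ {a} → a ∈ xs → T (p a) → T (q a)
      others a∈ pa with h (there a∈) pa
      ... | inj₁ qa = qa
      ... | inj₂ refl = ⊥-elim (All.lookup y∉ a∈ refl)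

  countᵇ-none : ∀ (p : A → Bool) xs → (∀ {a} → a ∈ xs → ¬ T (p a)) → countᵇ p xs ≡ 0
  countᵇ-none p [] h = refl
  countᵇ-none p (x ∷ xs) h = trans (countᵇ-there p xs (h (here refl))) (countᵇ-none p xs (h ∘ there))

  countᵇ-∨ : ∀ (p q r : A → Bool) xs → (∀ a → p a ≡ (q a ∨ r a)) → (∀ a → T (q a) → ¬ T (r a))
    → countᵇ p xs ≡ countᵇ q xs + countᵇ r xs
  countᵇ-∨ p q r [] _ _ = refl
  countᵇ-∨ p q r (x ∷ xs) split disjoint with T? (q x) | T? (r x)
  ... | yes qx | yes rx = ⊥-elim (disjoint x qx rx)
  ... | yes qx | no ¬rx rewrite countᵇ-here p xs (subst T (sym (split x)) (Equivalence.from T-∨ (inj₁ qx))) | countᵇ-here q xs qx | countᵇ-there r xs ¬rx =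
    cong suc (countᵇ-∨ p q r xs split disjoint)
  ... | no ¬qx | yes rx rewrite countᵇ-here p xs (subst T (sym (split x)) (Equivalence.from T-∨ (inj₂ rx))) | countᵇ-there q xs ¬qx | countᵇ-here r xs rx =
    trans (cong suc (countᵇ-∨ p q r xs split disjoint)) (sym (+-suc _ _))
  ... | no ¬qx | no ¬rx rewrite countᵇ-there q xs ¬qx | countᵇ-there r xs ¬rx =
    trans (countᵇ-there p xs λ px → [ ¬qx , ¬rx ] (Equivalence.to T-∨ (subst T (split x) px))) (countᵇ-∨ p q r xs split disjoint)

countᵇ-map : ∀ {A B : Set} (p : B → Bool) (f : A → B) xs → countᵇ p (map f xs) ≡ countᵇ (p ∘ f) xs
countᵇ-map p f [] = refl
countᵇ-map p f (x ∷ xs) with T? (p (f x))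
... | yes pfx rewrite countᵇ-here p (map f xs) pfx | countᵇ-here (p ∘ f) xs pfx = cong suc (countᵇ-map p f xs)
... | no ¬pfx rewrite countᵇ-there p (map f xs) ¬pfx | countᵇ-there (p ∘ f) xs ¬pfx = countᵇ-map p f xs

count-countᵇ : ∀ v xs → count v xs ≡ countᵇ (_≡ᵇ v) xs
count-countᵇ v [] = refl
count-countᵇ v (x ∷ xs) with x ≡ᵇ v
... | true = cong suc (count-countᵇ v xs)
... | false = count-countᵇ v xs

countᵇ-positions : ∀ xs v → countᵇ (λ c → xs ! c ≡ᵇ v) (upTo (length xs)) ≡ count v xs
countᵇ-positions xs v = begin
    countᵇ (λ c → xs ! c ≡ᵇ v) (upTo (length xs))    ≡⟨ sym (countᵇ-map (_≡ᵇ v) (xs !_) (upTo (length xs))) ⟩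
    countᵇ (_≡ᵇ v) (map (xs !_) (upTo (length xs)))  ≡⟨ cong (countᵇ (_≡ᵇ v)) positions ⟩
    countᵇ (_≡ᵇ v) xs                                ≡⟨ sym (count-countᵇ v xs) ⟩
    count v xs                                       ∎
  where
    open ≡-Reasoning
    positions : map (xs !_) (upTo (length xs)) ≡ xs
    positions = trans (map-upTo (xs !_) (length xs)) (applyUpTo-! (xs !_) xs (λ _ _ → refl))

cellsOf-∈⁺ : ∀ G r c → InShape G r c → (r , c) ∈ cellsOf G
cellsOf-∈⁺ G r c inShape = ∈-concat⁺′ (∈-map⁺ (λ c → r , c) (∈-upTo⁺ inShape)) (∈-map⁺ rowCells (∈-upTo⁺ r<))
  where
    rowCells : ℕ → List (ℕ × ℕ)
    rowCells r = map (λ c → r , c) (upTo (length (row G r)))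
    r< : r < length G
    r< with r <? length G
    ... | yes r<G = r<G
    ... | no r≮G = ⊥-elim (subst (λ w → c < length w → ⊥) (sym (row-outside G r (≮⇒≥ r≮G))) (λ ()) inShape)

cellsOf-∈⁻ : ∀ G p → p ∈ cellsOf G → InShape G (proj₁ p) (proj₂ p)
cellsOf-∈⁻ G p p∈ with ∈-concat⁻′ (map (λ r → map (λ c → r , c) (upTo (length (row G r)))) (upTo (length G))) p∈
... | _ , p∈row , row∈ with ∈-map⁻ (λ r → map (λ c → r , c) (upTo (length (row G r)))) row∈
...   | r , _ , refl with ∈-map⁻ (λ c → r , c) p∈row
...     | c , c∈ , refl = ∈-upTo⁻ c∈

-- distinct rows contribute disjoint lists of cells
cellsOf-unique : ∀ G → Unique (cellsOf G)
cellsOf-unique G = rows (upTo (length G)) (UP.upTo⁺ _)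
  where
    rowCells : ℕ → List (ℕ × ℕ)
    rowCells r = map (λ c → r , c) (upTo (length (row G r)))
    rowOf : ∀ {v r} → v ∈ rowCells r → proj₁ v ≡ r
    rowOf {r = r} v∈ with ∈-map⁻ (λ c → r , c) v∈
    ... | _ , _ , refl = refl
    rowsOf : ∀ rs {v} → v ∈ concat (map rowCells rs) → proj₁ v ∈ rs
    rowsOf rs v∈ with ∈-concat⁻′ (map rowCells rs) v∈
    ... | _ , v∈row , row∈ with ∈-map⁻ rowCells row∈
    ...   | r , r∈ , refl rewrite rowOf {r = r} v∈row = r∈
    rows : ∀ rs → Unique rs → Unique (concat (map rowCells rs))
    rows [] _ = []
    rows (r ∷ rs) (r∉ ∷ u) = UP.++⁺ (UP.map⁺ (cong proj₂) (UP.upTo⁺ _)) (rows rs u)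
      λ (v∈r , v∈rs) → All.lookup r∉ (rowsOf rs v∈rs) (sym (rowOf v∈r))

phiRow-letters : ∀ G j → phiRow G j ≡ letters 0 (map (count (suc j)) G)
phiRow-letters G j = trans (cong concat (map-upTo _ (length G))) (from 0 G)
  where
    from : ∀ k G → concat (applyUpTo (λ i → replicate (count (suc j) (row G i)) (suc (k + i))) (length G))
                 ≡ letters k (map (count (suc j)) G)
    from k [] = refl
    from k (r ∷ G) = cong₂ _++_ (cong (replicate (count (suc j) r) ∘ suc) (+-identityʳ k))
      (trans (cong concat (applyUpTo-cong (length G) (λ i → cong (replicate (count (suc j) (row G i)) ∘ suc) (+-suc k i))))
             (from (suc k) G))

!-map-count : ∀ v G i → map (count v) G ! i ≡ count v (row G i)
!-map-count v [] i = refl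
!-map-count v (r ∷ G) zero = refl
!-map-count v (r ∷ G) (suc i) = !-map-count v G i

module Ribbon (α s : List ℕ) (ribbon : IsRibbon α s) where

  end : ℕ → ℕ
  end j = s ! j + α ! j

  shifts : ∀ j → suc j < length α → s ! suc j ≤ s ! j × end (suc j) ≤ end j
  shifts = proj₁ (proj₂ ribbon)

  no-square : ∀ j c → ¬ (InRibbon α s j c × InRibbon α s j (suc c) × InRibbon α s (suc j) c × InRibbon α s (suc j) (suc c))
  no-square = proj₂ (proj₂ ribbon)

  inRibbon-< : ∀ {j c} → InRibbon α s j c → j < length α
  inRibbon-< {j} {c} (s≤c , c<end) with j <? length α
  ... | yes j<ℓ = j<ℓ
  ... | no j≮ℓ = ⊥-elim (<⇒≱ c<end (subst (_≤ c) (sym (trans (cong (s ! j +_) (!-outside α j (≮⇒≥ j≮ℓ))) (+-identityʳ _))) s≤c))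

  start-antitone : ∀ {j j'} → j ≤ j' → j' < length α → s ! j' ≤ s ! j
  start-antitone j≤j' = go (≤⇒≤′ j≤j')
    where
      go : ∀ {j j'} → j ≤′ j' → j' < length α → s ! j' ≤ s ! j
      go ≤′-refl _ = ≤-refl
      go (≤′-step {j''} h) j'<ℓ = ≤-trans (proj₁ (shifts j'' j'<ℓ)) (go h (<-trans (n<1+n _) j'<ℓ))

  overlap-column : ∀ j c → suc j < length α → InRibbon α s j c → InRibbon α s (suc j) c
    → c ≤ s ! j × end (suc j) ≤ suc c
  overlap-column j c j+1<ℓ rj@(s≤c , _) rj+1@(s'≤c , _) = firstOfTop c rj rj+1 , lastOfBottom
    where
      firstOfTop : ∀ c' → InRibbon α s j c' → InRibbon α s (suc j) c' → c' ≤ s ! j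
      firstOfTop zero _ _ = z≤n
      firstOfTop (suc c₀) r₁ r₂ with suc c₀ ≤? s ! j
      ... | yes c≤s = c≤s
      ... | no c≰s = ⊥-elim (no-square j c₀
            ((≤-pred (≰⇒> c≰s) , <-trans (n<1+n c₀) (proj₂ r₁)) , r₁ ,
             (≤-trans (proj₁ (shifts j j+1<ℓ)) (≤-pred (≰⇒> c≰s)) , <-trans (n<1+n c₀) (proj₂ r₂)) , r₂))
      lastOfBottom : end (suc j) ≤ suc c
      lastOfBottom with end (suc j) ≤? suc c
      ... | yes e≤ = e≤
      ... | no e≰ = ⊥-elim (no-square j c
            (rj , (≤-trans s≤c (n≤1+n c) , <-≤-trans (≰⇒> e≰) (proj₂ (shifts j j+1<ℓ))) , rj+1 , (≤-trans s'≤c (n≤1+n c) , ≰⇒> e≰)))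

  -- a filling of the ribbon has strictly increasing columns as soon as
  -- consecutive rows are strictly increasing where they overlap, since a
  -- column meeting rows j and j' meets every row in between
  columns-from-consecutive : ∀ (f : ℕ → ℕ → ℕ)
    → (∀ j c → suc j < length α → InRibbon α s j c → InRibbon α s (suc j) c → f j c < f (suc j) c)
    → ∀ j j' c → j < j' → InRibbon α s j c → InRibbon α s j' c → f j c < f j' c
  columns-from-consecutive f step j j' c j<j' = chain (≤⇒≤′ j<j')
    where
      chain : ∀ {j j'} → suc j ≤′ j' → InRibbon α s j c → InRibbon α s j' c → f j c < f j' c
      chain {j} ≤′-refl r r' = step j c (inRibbon-< r') r r'
      chain {j} (≤′-step {j''} j<j'') r r' =
        <-trans (chain j<j'' r middle) (step j'' c (inRibbon-< r') middle r')
        where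
          middle : InRibbon α s j'' c
          middle = ≤-trans (start-antitone (≤-trans (n≤1+n j) (≤′⇒≤ j<j'')) (<-trans (n<1+n j'') (inRibbon-< r'))) (proj₁ r) ,
                   <-≤-trans (proj₂ r') (proj₂ (shifts j'' (inRibbon-< r')))

-- Semistandard tableaux of content α.  The hypotheses are the components
-- of Tab ν α G, with the shape condition weakened to "rows shrink".

module Tableau (G : List (List ℕ)) (α : List ℕ)
  (rowsSorted : All (Linked _≤_) G)
  (columnsStrict : ∀ r c → InShape G (suc r) c → entry G r c < entry G (suc r) c)
  (rowsShrink : ∀ r → length (row G (suc r)) ≤ length (row G r))
  (entriesBounded : ∀ r c → InShape G r c → 1 ≤ entry G r c × entry G r c ≤ length α)
  (content : ∀ j → j < length α → countT (suc j) G ≡ α ! j)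
  (αPositive : All (0 <_) α)
  where

  above : ∀ {r r' c} → r ≤ r' → InShape G r' c → InShape G r c
  above r≤r' = go (≤⇒≤′ r≤r')
    where
      go : ∀ {r r' c} → r ≤′ r' → InShape G r' c → InShape G r c
      go ≤′-refl inShape = inShape
      go (≤′-step r≤r') inShape = go r≤r' (<-≤-trans inShape (rowsShrink _))

  column-< : ∀ {r r' c} → r < r' → InShape G r' c → entry G r c < entry G r' c
  column-< r<r' = go (≤⇒≤′ r<r')
    where
      go : ∀ {r r' c} → suc r ≤′ r' → InShape G r' c → entry G r c < entry G r' c
      go {r} {c = c} ≤′-refl inShape = columnsStrict r c inShape
      go {c = c} (≤′-step {r'} r<r') inShape = <-trans (go r<r' (above (n≤1+n r') inShape)) (columnsStrict r' c inShape)

  row-≤ : ∀ r {c c'} → c ≤ c' → InShape G r c' → entry G r c ≤ entry G r c'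
  row-≤ r {c} {c'} c≤c' inShape = linked-mono (row G r) c c' (row-All G r rowsSorted []) c≤c' inShape

  northwest-< : ∀ {r c r' c'} → InShape G r' c' → c ≤ c' → r < r' → entry G r c < entry G r' c'
  northwest-< {r} inShape c≤c' r<r' = ≤-<-trans (row-≤ r c≤c' (above (<⇒≤ r<r') inShape)) (column-< r<r' inShape)

  -- Standardization order and ranks.  Ĝ carries suc (rank x) in the cell x,
  -- where rank x is the number of cells preceding x.

  cells : List (ℕ × ℕ)
  cells = cellsOf G

  value : ℕ × ℕ → ℕ
  value p = entry G (proj₁ p) (proj₂ p)

  precedes : ℕ × ℕ → ℕ × ℕ → Bool
  precedes p q = before (value p , proj₂ p) (value q , proj₂ q)

  rank : ℕ × ℕ → ℕ
  rank x = countᵇ (λ p → precedes p x) cells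

  Precedes : ℕ × ℕ → ℕ × ℕ → Set
  Precedes p q = value p < value q ⊎ (value p ≡ value q × proj₂ p < proj₂ q)

  precedes⇔ : ∀ p q → T (precedes p q) ⇔ Precedes p q
  precedes⇔ p q = mk⇔ to from
    where
      to : T (precedes p q) → Precedes p q
      to t with Equivalence.to T-∨ t
      ... | inj₁ lt = inj₁ (<ᵇ⇒< _ _ lt)
      ... | inj₂ t' with Equivalence.to T-∧ t'
      ...   | eq , lt = inj₂ (≡ᵇ⇒≡ _ _ eq , <ᵇ⇒< _ _ lt)
      from : Precedes p q → T (precedes p q)
      from (inj₁ lt) = Equivalence.from T-∨ (inj₁ (<⇒<ᵇ lt))
      from (inj₂ (eq , lt)) = Equivalence.from T-∨ (inj₂ (Equivalence.from T-∧ (≡⇒≡ᵇ _ _ eq , <⇒<ᵇ lt)))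

  precedes-irrefl : ∀ p → ¬ T (precedes p p)
  precedes-irrefl p t with Equivalence.to (precedes⇔ p p) t
  ... | inj₁ lt = <-irrefl refl lt
  ... | inj₂ (_ , lt) = <-irrefl refl lt

  precedes-trans : ∀ p q r → T (precedes p q) → T (precedes q r) → T (precedes p r)
  precedes-trans p q r t u = Equivalence.from (precedes⇔ p r)
    (combine (Equivalence.to (precedes⇔ p q) t) (Equivalence.to (precedes⇔ q r) u))
    where
      combine : Precedes p q → Precedes q r → Precedes p r
      combine (inj₁ a) (inj₁ b) = inj₁ (<-trans a b)
      combine (inj₁ a) (inj₂ (b , _)) = inj₁ (<-≤-trans a (≤-reflexive b))
      combine (inj₂ (a , _)) (inj₁ b) = inj₁ (≤-<-trans (≤-reflexive a) b)
      combine (inj₂ (a , a')) (inj₂ (b , b')) = inj₂ (trans a b , <-trans a' b')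

  rank-< : ∀ {p q} → p ∈ cells → T (precedes p q) → rank p < rank q
  rank-< {p} {q} p∈ t = countᵇ-strict (λ a → precedes a p) (λ a → precedes a q) cells p p∈ t (precedes-irrefl p)
    (λ {a} _ u → precedes-trans a p q u t)

  cellsAtMost : ℕ → ℕ
  cellsAtMost m = countᵇ (λ p → value p <ᵇ suc m) cells

  cellsWith : ℕ → ℕ
  cellsWith v = countᵇ (λ p → value p ≡ᵇ v) cells

  cellsWith-countT : ∀ v → cellsWith v ≡ countT v G
  cellsWith-countT v = begin
      countᵇ P (concat (map rowCells (upTo (length G))))          ≡⟨ countᵇ-concat P (map rowCells (upTo (length G))) ⟩
      sum (map (countᵇ P) (map rowCells (upTo (length G))))       ≡⟨ cong sum (sym (map-∘ (upTo (length G)))) ⟩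
      sum (map (countᵇ P ∘ rowCells) (upTo (length G)))           ≡⟨ cong sum (map-upTo _ (length G)) ⟩
      sum (applyUpTo (countᵇ P ∘ rowCells) (length G))            ≡⟨ cong sum (applyUpTo-cong (length G) perRow) ⟩
      sum (applyUpTo (λ r → count v (row G r)) (length G))        ≡⟨ cong sum (applyUpTo-row (count v) G) ⟩
      sum (map (count v) G)                                       ∎
    where
      open ≡-Reasoning
      P : ℕ × ℕ → Bool
      P p = value p ≡ᵇ v
      rowCells : ℕ → List (ℕ × ℕ)
      rowCells r = map (λ c → r , c) (upTo (length (row G r)))
      perRow : ∀ r → countᵇ P (rowCells r) ≡ count v (row G r)
      perRow r = trans (countᵇ-map P (λ c → r , c) (upTo (length (row G r)))) (countᵇ-positions (row G r) v)

  cellsAtMost-zero : cellsAtMost 0 ≡ 0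
  cellsAtMost-zero = countᵇ-none (λ p → value p <ᵇ 1) cells λ {a} a∈ t →
    <⇒≱ (<ᵇ⇒< _ _ t) (proj₁ (entriesBounded _ _ (cellsOf-∈⁻ G a a∈)))

  cellsAtMost-suc : ∀ m → cellsAtMost (suc m) ≡ cellsAtMost m + cellsWith (suc m)
  cellsAtMost-suc m = countᵇ-∨ (λ p → value p <ᵇ suc (suc m)) (λ p → value p <ᵇ suc m) (λ p → value p ≡ᵇ suc m) cells
    (λ a → <ᵇ-suc (value a) (suc m)) (λ a lt eq → <-irrefl (≡ᵇ⇒≡ (value a) (suc m) eq) (<ᵇ⇒< (value a) (suc m) lt))
    where
      <ᵇ-suc : ∀ x m → (x <ᵇ suc m) ≡ ((x <ᵇ m) ∨ (x ≡ᵇ m))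
      <ᵇ-suc zero zero = refl
      <ᵇ-suc zero (suc m) = refl
      <ᵇ-suc (suc x) zero = refl
      <ᵇ-suc (suc x) (suc m) = <ᵇ-suc x m

  cellsAtMost-partialSum : ∀ m → m ≤ length α → cellsAtMost m ≡ sum (take m α)
  cellsAtMost-partialSum zero _ = cellsAtMost-zero
  cellsAtMost-partialSum (suc m) m<ℓ = begin
      cellsAtMost (suc m)                  ≡⟨ cellsAtMost-suc m ⟩
      cellsAtMost m + cellsWith (suc m)    ≡⟨ cong₂ _+_ (cellsAtMost-partialSum m (<⇒≤ m<ℓ)) (trans (cellsWith-countT (suc m)) (content m m<ℓ)) ⟩
      sum (take m α) + α ! m               ≡⟨ sym (sum-take-suc α m m<ℓ) ⟩
      sum (take (suc m) α)                 ∎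
    where open ≡-Reasoning

  -- the N_m strictly increase since every letter occurs
  cellsAtMost-< : ∀ m → m < length α → cellsAtMost m < cellsAtMost (suc m)
  cellsAtMost-< m m<ℓ rewrite cellsAtMost-suc m | cellsWith-countT (suc m) | content m m<ℓ =
    m<m+n (cellsAtMost m) (positive-! α m αPositive m<ℓ)

  cellsAtMost-≤-rank : ∀ m x → m < value x → cellsAtMost m ≤ rank x
  cellsAtMost-≤-rank m x m<x = countᵇ-mono (λ p → value p <ᵇ suc m) (λ p → precedes p x) cells
    λ {a} _ t → Equivalence.from (precedes⇔ a x) (inj₁ (≤-<-trans (≤-pred (<ᵇ⇒< _ _ t)) m<x))

  -- … and a cell with entry ≤ m comes before some of them, namely itself
  rank-<-cellsAtMost : ∀ m x → x ∈ cells → value x ≤ m → rank x < cellsAtMost m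
  rank-<-cellsAtMost m x x∈ x≤m = countᵇ-strict (λ p → precedes p x) (λ p → value p <ᵇ suc m) cells x x∈
    (<⇒<ᵇ (s≤s x≤m)) (precedes-irrefl x) λ {a} _ t → <⇒<ᵇ (s≤s (≤-trans (earlier a t) x≤m))
    where
      earlier : ∀ a → T (precedes a x) → value a ≤ value x
      earlier a t with Equivalence.to (precedes⇔ a x) t
      ... | inj₁ lt = <⇒≤ lt
      ... | inj₂ (eq , _) = ≤-reflexive eq

  value-from-rank : ∀ m x → x ∈ cells → cellsAtMost m ≤ rank x → rank x < cellsAtMost (suc m) → value x ≡ suc m
  value-from-rank m x x∈ low high with <-cmp (value x) (suc m)
  ... | tri≈ _ eq _ = eq
  ... | tri< lt _ _ = ⊥-elim (<⇒≱ (rank-<-cellsAtMost m x x∈ (≤-pred lt)) low)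
  ... | tri> _ _ gt = ⊥-elim (<⇒≱ high (cellsAtMost-≤-rank (suc m) x gt))

  row-standardize : ∀ r → row (standardize G) r ≡ map (stdEntry G r) (upTo (length (row G r)))
  row-standardize r with r <? length G
  ... | yes r<G = row-tabulate (λ r → map (stdEntry G r) (upTo (length (row G r)))) (length G) r r<G
  ... | no r≮G rewrite row-outside G r (≮⇒≥ r≮G) =
    row-outside (standardize G) r (≤-trans (≤-reflexive (length-tabulate _ (length G))) (≮⇒≥ r≮G))

  InShape-standardize : ∀ r c → InShape (standardize G) r c ⇔ InShape G r c
  InShape-standardize r c rewrite row-standardize r | length-tabulate (stdEntry G r) (length (row G r)) = mk⇔ (λ h → h) (λ h → h)

  entry-standardize : ∀ r c → InShape G r c → entry (standardize G) r c ≡ suc (rank (r , c))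
  entry-standardize r c inShape rewrite row-standardize r = !-tabulate (stdEntry G r) (length (row G r)) c inShape

  RankDescent : ℕ → Set
  RankDescent i = ∃[ x ] ∃[ y ] (x ∈ cells × y ∈ cells × suc (rank x) ≡ i × suc (rank y) ≡ suc i × proj₁ x < proj₁ y)

  descent⇔rankDescent : ∀ i → Descent (standardize G) i ⇔ RankDescent i
  descent⇔rankDescent i = mk⇔ to from
    where
      to : Descent (standardize G) i → RankDescent i
      to (r , c , r' , c' , in₁ , in₂ , e₁ , e₂ , r<r') =
        (r , c) , (r' , c') , cellsOf-∈⁺ G r c in₁' , cellsOf-∈⁺ G r' c' in₂' ,
        trans (sym (entry-standardize r c in₁')) e₁ , trans (sym (entry-standardize r' c' in₂')) e₂ , r<r'
        where
          in₁' : InShape G r c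
          in₁' = Equivalence.to (InShape-standardize r c) in₁
          in₂' : InShape G r' c'
          in₂' = Equivalence.to (InShape-standardize r' c') in₂
      from : RankDescent i → Descent (standardize G) i
      from ((r , c) , (r' , c') , x∈ , y∈ , ex , ey , r<r') =
        r , c , r' , c' , Equivalence.from (InShape-standardize r c) in₁ , Equivalence.from (InShape-standardize r' c') in₂ ,
        trans (entry-standardize r c in₁) ex , trans (entry-standardize r' c' in₂) ey , r<r'
        where
          in₁ : InShape G r c
          in₁ = cellsOf-∈⁻ G (r , c) x∈
          in₂ : InShape G r' c'
          in₂ = cellsOf-∈⁻ G (r' , c') y∈

  strip : ∀ {p q} → q ∈ cells → value p ≡ value q → proj₂ p ≤ proj₂ q → proj₁ q ≤ proj₁ p
  strip {p} {q} q∈ same p≤q with proj₁ q ≤? proj₁ p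
  ... | yes q≤p = q≤p
  ... | no q≰p = ⊥-elim (<-irrefl same (northwest-< (cellsOf-∈⁻ G q q∈) p≤q (≰⇒> q≰p)))

  rank-rightmost : ∀ m x → x ∈ cells → value x ≡ suc m
    → (∀ {q} → q ∈ cells → value q ≡ suc m → proj₂ q ≤ proj₂ x) → suc (rank x) ≡ cellsAtMost (suc m)
  rank-rightmost m x x∈ vx rightmost = ≤-antisym (rank-<-cellsAtMost (suc m) x x∈ (≤-reflexive vx))
    (countᵇ-but-one (λ p → value p <ᵇ suc (suc m)) (λ p → precedes p x) cells x (cellsOf-unique G) earlier)
    where
      earlier : ∀ {q} → q ∈ cells → T (value q <ᵇ suc (suc m)) → T (precedes q x) ⊎ q ≡ x
      earlier {q} q∈ t with <-cmp (value q) (suc m)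
      ... | tri< lt _ _ = inj₁ (Equivalence.from (precedes⇔ q x) (inj₁ (subst (value q <_) (sym vx) lt)))
      ... | tri> _ _ gt = ⊥-elim (<⇒≱ gt (≤-pred (<ᵇ⇒< _ _ t)))
      ... | tri≈ _ vq _ with <-cmp (proj₂ q) (proj₂ x)
      ...   | tri< lt _ _ = inj₁ (Equivalence.from (precedes⇔ q x) (inj₂ (trans vq (sym vx) , lt)))
      ...   | tri> _ _ gt = ⊥-elim (<⇒≱ gt (rightmost q∈ vq))
      ...   | tri≈ _ cq _ = inj₂ (cong₂ _,_
              (≤-antisym (strip q∈ (trans vx (sym vq)) (≤-reflexive (sym cq))) (strip x∈ (trans vq (sym vx)) (≤-reflexive cq))) cq)

  rank-leftmost : ∀ m y → y ∈ cells → value y ≡ suc m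
    → (∀ {q} → q ∈ cells → value q ≡ suc m → proj₂ y ≤ proj₂ q) → rank y ≡ cellsAtMost m
  rank-leftmost m y y∈ vy leftmost = ≤-antisym
    (countᵇ-mono (λ p → precedes p y) (λ p → value p <ᵇ suc m) cells λ {q} q∈ t → <⇒<ᵇ (smaller q q∈ (Equivalence.to (precedes⇔ q y) t)))
    (cellsAtMost-≤-rank m y (≤-reflexive (sym vy)))
    where
      smaller : ∀ q → q ∈ cells → Precedes q y → value q < suc m
      smaller q _ (inj₁ lt) = subst (value q <_) vy lt
      smaller q q∈ (inj₂ (vq , lt)) = ⊥-elim (<⇒≱ lt (leftmost q∈ (trans vq vy)))

  -- (1a) Ĝ has a descent at N_{j+1} iff some j+1 of G lies in a row above some j+2
  -- (Descent G applied to G itself expresses the latter).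
  descent-at-partialSum : ∀ j → suc j < length α
    → Descent (standardize G) (sum (take (suc j) α)) ⇔ Descent G (suc j)
  descent-at-partialSum j j+1<ℓ = mk⇔ (toLetters ∘ Equivalence.to (descent⇔rankDescent N)) (Equivalence.from (descent⇔rankDescent N) ∘ fromLetters)
    where
      N : ℕ
      N = sum (take (suc j) α)
      N≡ : cellsAtMost (suc j) ≡ N
      N≡ = cellsAtMost-partialSum (suc j) (<⇒≤ j+1<ℓ)
      toLetters : RankDescent N → Descent G (suc j)
      toLetters (x , y , x∈ , y∈ , ex , ey , x↑y) =
        proj₁ x , proj₂ x , proj₁ y , proj₂ y , cellsOf-∈⁻ G x x∈ , cellsOf-∈⁻ G y y∈ , vx , vy , x↑y
        where
          rx : suc (rank x) ≡ cellsAtMost (suc j)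
          rx = trans ex (sym N≡)
          ry : rank y ≡ cellsAtMost (suc j)
          ry = trans (suc-injective ey) (sym N≡)
          vx : value x ≡ suc j
          vx = value-from-rank j x x∈ (≤-pred (subst (cellsAtMost j <_) (sym rx) (cellsAtMost-< j (<-trans (n<1+n j) j+1<ℓ))))
                 (subst (rank x <_) rx (n<1+n _))
          vy : value y ≡ suc (suc j)
          vy = value-from-rank (suc j) y y∈ (≤-reflexive (sym ry)) (subst (_< cellsAtMost (suc (suc j))) (sym ry) (cellsAtMost-< (suc j) j+1<ℓ))
      fromLetters : Descent G (suc j) → RankDescent N
      fromLetters (ra , ca , rb , cb , ina , inb , va , vb , ra<rb)
        with largest (λ q → value q ≟ suc j) proj₂ (cellsOf-∈⁺ G ra ca ina) va
           | smallest (λ q → value q ≟ suc (suc j)) proj₂ (cellsOf-∈⁺ G rb cb inb) vb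
      ... | x , x∈ , vx , rightmost | y , y∈ , vy , leftmost =
        x , y , x∈ , y∈ , trans (rank-rightmost j x x∈ vx rightmost) N≡ ,
        cong suc (trans (rank-leftmost (suc j) y y∈ vy leftmost) N≡) ,
        ≤-<-trans (strip x∈ (trans va (sym vx)) (rightmost (cellsOf-∈⁺ G ra ca ina) va))
                  (<-≤-trans ra<rb (strip (cellsOf-∈⁺ G rb cb inb) (trans vy (sym vb)) (leftmost (cellsOf-∈⁺ G rb cb inb) vb)))

  descent⇒InS : ∀ i → Descent (standardize G) i → InS α i
  descent⇒InS i d with Equivalence.to (descent⇔rankDescent i) d
  ... | x , y , x∈ , y∈ , ex , ey , x↑y = atPartialSum (value x) refl
    where
      ry : rank y ≡ suc (rank x)
      ry = suc-injective (trans ey (cong suc (sym ex)))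
      yNotBefore : ¬ Precedes y x
      yNotBefore p = <-asym (rank-< y∈ (Equivalence.from (precedes⇔ y x) p)) (subst (rank x <_) (sym ry) (n<1+n _))
      x<y : value x < value y
      x<y with <-cmp (value x) (value y)
      ... | tri< lt _ _ = lt
      ... | tri> _ _ gt = ⊥-elim (yNotBefore (inj₁ gt))
      ... | tri≈ _ eq _ with proj₂ x ≤? proj₂ y
      ...   | no x≰y = ⊥-elim (yNotBefore (inj₂ (sym eq , ≰⇒> x≰y)))
      ...   | yes x≤y = ⊥-elim (<⇒≱ x↑y (strip y∈ eq x≤y))
      y≤ℓ : value y ≤ length α
      y≤ℓ = proj₂ (entriesBounded _ _ (cellsOf-∈⁻ G y y∈))
      i≡ : i ≡ cellsAtMost (value x)
      i≡ = ≤-antisym (subst (_≤ cellsAtMost (value x)) ex (rank-<-cellsAtMost (value x) x x∈ ≤-refl))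
                     (subst (cellsAtMost (value x) ≤_) (trans ry ex) (cellsAtMost-≤-rank (value x) y x<y))
      atPartialSum : ∀ v → value x ≡ v → InS α i
      atPartialSum zero vx = ⊥-elim (<-irrefl (sym vx) (proj₁ (entriesBounded _ _ (cellsOf-∈⁻ G x x∈))))
      atPartialSum (suc m) vx = m , m<ℓ , trans i≡ (trans (cong cellsAtMost vx) (cellsAtMost-partialSum (suc m) (<⇒≤ m<ℓ)))
        where
          m<ℓ : suc m < length α
          m<ℓ = subst (_< length α) vx (<-≤-trans x<y y≤ℓ)

  row-phi : ∀ j → j < length α → row (phi G α) j ≡ phiRow G j
  row-phi j j<ℓ = row-tabulate (phiRow G) (length α) j j<ℓ

  length-phiRow : ∀ j → j < length α → length (phiRow G j) ≡ α ! j
  length-phiRow j j<ℓ = trans (cong length (phiRow-letters G j)) (trans (length-letters 0 (map (count (suc j)) G)) (content j j<ℓ))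

  phiRow-sorted : ∀ j → Linked _≤_ (phiRow G j)
  phiRow-sorted j = subst (Linked _≤_) (sym (phiRow-letters G j)) (letters-sorted 0 (map (count (suc j)) G))

  count-phiRow : ∀ i j → count (suc i) (phiRow G j) ≡ count (suc j) (row G i)
  count-phiRow i j = trans (cong (count (suc i)) (phiRow-letters G j)) (trans (count-letters 0 (map (count (suc j)) G) i) (!-map-count (suc j) G i))

  ∈-phiRow : ∀ {x} j → x ∈ phiRow G j → ∃[ a ] (x ≡ suc a × ∃[ c ] (InShape G a c × entry G a c ≡ suc j))
  ∈-phiRow {x} j x∈ with ∈-letters 0 (map (count (suc j)) G) (subst (x ∈_) (phiRow-letters G j) x∈)
  ... | a , x≡ , occurs with count-pos (suc j) (row G a) (subst (0 <_) (!-map-count (suc j) G a) occurs)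
  ...   | c , inShape , e = a , x≡ , c , inShape , e

  phiRow-∋ : ∀ j a c → InShape G a c → entry G a c ≡ suc j → ∃[ k ] (k < length (phiRow G j) × phiRow G j ! k ≡ suc a)
  phiRow-∋ j a c inShape e = count-pos (suc a) (phiRow G j)
    (subst (0 <_) (sym (count-phiRow a j)) (pos-count (suc j) (row G a) c inShape e))

  length-phi : map length (phi G α) ≡ α
  length-phi = begin
      map length (map (phiRow G) (upTo (length α)))   ≡⟨ sym (map-∘ (upTo (length α))) ⟩
      map (length ∘ phiRow G) (upTo (length α))        ≡⟨ map-upTo _ (length α) ⟩
      applyUpTo (length ∘ phiRow G) (length α)         ≡⟨ applyUpTo-! (length ∘ phiRow G) α length-phiRow ⟩
      α                                                ∎
    where open ≡-Reasoning

  phi-sorted : All (Linked _≤_) (phi G α)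
  phi-sorted = AllP.map⁺ (All.universal phiRow-sorted (upTo (length α)))

  count-phi-prefix : ∀ i m → m ≤ length α → count (suc i) (concat (take m (phi G α))) ≡ atMost m (row G i)
  count-phi-prefix i m m≤ℓ = begin
      count (suc i) (concat (take m (map (phiRow G) (upTo (length α)))))  ≡⟨ cong (λ z → count (suc i) (concat (take m z))) (map-upTo (phiRow G) (length α)) ⟩
      count (suc i) (concat (take m (applyUpTo (phiRow G) (length α))))    ≡⟨ cong (count (suc i) ∘ concat) (take-applyUpTo (phiRow G) m (length α) m≤ℓ) ⟩
      count (suc i) (concat (applyUpTo (phiRow G) m))                      ≡⟨ count-concat (suc i) (applyUpTo (phiRow G) m) ⟩
      sum (map (count (suc i)) (applyUpTo (phiRow G) m))                   ≡⟨ cong sum (map-applyUpTo (phiRow G) (count (suc i)) m) ⟩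
      sum (applyUpTo (λ k → count (suc i) (phiRow G k)) m)                 ≡⟨ cong sum (applyUpTo-cong m (count-phiRow i)) ⟩
      sum (applyUpTo (λ k → count (suc k) (row G i)) m)                    ≡⟨ sum-counts m (row G i) (All-! (row G i) (λ c c< → proj₁ (entriesBounded i c c<))) ⟩
      atMost m (row G i)                                                   ∎
    where open ≡-Reasoning

  -- (2) the reading word of φ(G) is Yamanouchi: by column strictness, row i+1
  -- of G has no more entries ≤ j+1 than row i has entries ≤ j
  phi-yamanouchi : Yamanouchi (readingWord (phi G α))
  phi-yamanouchi k i = yamanouchi-rows (suc i) (suc (suc i)) (phi G α) prefixes k
    where
      ℓφ : length (phi G α) ≡ length α
      ℓφ = length-tabulate (phiRow G) (length α)
      prefixes : ∀ j → j < length (phi G α)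
        → count (suc (suc i)) (concat (take (suc j) (phi G α))) ≤ count (suc i) (concat (take j (phi G α)))
      prefixes j j< rewrite count-phi-prefix (suc i) (suc j) (subst (suc j ≤_) ℓφ j<)
                          | count-phi-prefix i j (<⇒≤ (subst (j <_) ℓφ j<)) =
        atMost-column j (row G (suc i)) (row G i) (rowsShrink i) (λ c c< below → ≤-pred (<-≤-trans (columnsStrict i c c<) below))

  module OnRibbon (s : List ℕ) (ribbon : IsRibbon α s) where
    open Ribbon α s ribbon

    fill : ℕ → ℕ → ℕ
    fill = fillEntry (phi G α) s

    fill-≡ : ∀ j c → j < length α → fill j c ≡ phiRow G j ! (c ∸ s ! j)
    fill-≡ j c j<ℓ = cong (_! (c ∸ s ! j)) (row-phi j j<ℓ)

    offset-< : ∀ {j c} → j < length α → InRibbon α s j c → c ∸ s ! j < length (phiRow G j)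
    offset-< {j} {c} j<ℓ (s≤c , c<end) = subst (c ∸ s ! j <_) (trans (m+n∸m≡n (s ! j) (α ! j)) (sym (length-phiRow j j<ℓ)))
      (∸-monoˡ-< c<end s≤c)

    -- at an overlap, row j contributes its first letter (1 + the highest row
    -- of G containing j+1) and row j+1 its last (1 + the lowest row containing
    -- j+2), so a letter descent j+1 makes the column strict
    overlap-strict : ∀ j c → suc j < length α → InRibbon α s j c → InRibbon α s (suc j) c
      → Descent G (suc j) → fill j c < fill (suc j) c
    overlap-strict j c j+1<ℓ top bottom (a , ca , b , cb , ina , inb , va , vb , a<b) with overlap-column j c j+1<ℓ top bottom
    ... | c≤s , end≤ with phiRow-∋ j a ca ina va | phiRow-∋ (suc j) b cb inb vb
    ...   | k , k< , ek | k' , k'< , ek' = begin-strict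
        fill j c                                       ≡⟨ fill-≡ j c j<ℓ ⟩
        phiRow G j ! (c ∸ s ! j)                       ≡⟨ cong (phiRow G j !_) (m≤n⇒m∸n≡0 c≤s) ⟩
        phiRow G j ! 0                                 ≤⟨ linked-mono (phiRow G j) 0 k (phiRow-sorted j) z≤n k< ⟩
        phiRow G j ! k                                 ≡⟨ ek ⟩
        suc a                                          <⟨ s≤s a<b ⟩
        suc b                                          ≡⟨ sym ek' ⟩
        phiRow G (suc j) ! k'                          ≤⟨ linked-mono (phiRow G (suc j)) k' (c ∸ s ! suc j) (phiRow-sorted (suc j)) k'≤ (offset-< j+1<ℓ bottom) ⟩
        phiRow G (suc j) ! (c ∸ s ! suc j)             ≡⟨ sym (fill-≡ (suc j) c j+1<ℓ) ⟩
        fill (suc j) c                                 ∎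
      where
        open ≤-Reasoning
        j<ℓ : j < length α
        j<ℓ = <⇒≤ j+1<ℓ
        -- the row j+1 ends in column c
        k'≤ : k' ≤ c ∸ s ! suc j
        k'≤ = ≤-pred (<-≤-trans k'< (≤-trans (≤-reflexive (length-phiRow (suc j) j+1<ℓ))
                (subst (α ! suc j ≤_) (+-∸-assoc 1 (proj₁ bottom)) (m+n≤o⇒m≤o∸n (α ! suc j) (subst (_≤ suc c) (+-comm (s ! suc j) _) end≤)))))

    strict-overlap : ∀ j c → suc j < length α → InRibbon α s j c → InRibbon α s (suc j) c
      → fill j c < fill (suc j) c → Descent G (suc j)
    strict-overlap j c j+1<ℓ top bottom lt
      with ∈-phiRow j (!-∈ (phiRow G j) (c ∸ s ! j) (offset-< (<⇒≤ j+1<ℓ) top))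
         | ∈-phiRow (suc j) (!-∈ (phiRow G (suc j)) (c ∸ s ! suc j) (offset-< j+1<ℓ bottom))
    ... | a , ea , ca , ina , va | b , eb , cb , inb , vb =
      a , ca , b , cb , ina , inb , va , vb , ≤-pred (subst₂ _<_ (trans (fill-≡ j c (<⇒≤ j+1<ℓ)) ea) (trans (fill-≡ (suc j) c j+1<ℓ) eb) lt)

    ColumnsStrict : Set
    ColumnsStrict = ∀ j j' c → j < j' → InRibbon α s j c → InRibbon α s j' c → fill j c < fill j' c

    columnsStrict⇔ : ColumnsStrict ⇔ (∀ j → suc j < length α → Overlap α s j → Descent G (suc j))
    columnsStrict⇔ = mk⇔
      (λ strict j j+1<ℓ (c , top , bottom) → strict-overlap j c j+1<ℓ top bottom (strict j (suc j) c (n<1+n j) top bottom))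
      (λ descents → columns-from-consecutive fill
        (λ j c j+1<ℓ top bottom → overlap-strict j c j+1<ℓ top bottom (descents j j+1<ℓ (c , top , bottom))))

    phi-LR⇔ : IsLR α s (phi G α) ⇔ (∀ j → suc j < length α → Overlap α s j → Descent G (suc j))
    phi-LR⇔ = mk⇔ (Equivalence.to columnsStrict⇔ ∘ (λ lr → proj₁ (proj₂ (proj₂ lr))))
                  (λ descents → length-phi , phi-sorted , Equivalence.from columnsStrict⇔ descents , phi-yamanouchi)

    LR⇔descents : IsLR α s (phi G α) ⇔ (∀ j → suc j < length α → Overlap α s j → Descent (standardize G) (sum (take (suc j) α)))
    LR⇔descents = mk⇔
      (λ lr j j+1<ℓ o → Equivalence.from (descent-at-partialSum j j+1<ℓ) (Equivalence.to phi-LR⇔ lr j j+1<ℓ o))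
      (λ descents → Equivalence.from phi-LR⇔ λ j j+1<ℓ o → Equivalence.to (descent-at-partialSum j j+1<ℓ) (descents j j+1<ℓ o))

-- Parts (b) and (c) are formal consequences of (a), for any notion D of descent

-- (b): on a connected ribbon every N_{j+1} is a descent, and (1b) says there are no others
connected-case : ∀ (α s : List ℕ) (D : ℕ → Set) (LR : Set)
  → (LR ⇔ (∀ j → suc j < length α → Overlap α s j → D (sum (take (suc j) α))))
  → (∀ i → D i → InS α i)
  → Connected α s → LR ⇔ (∀ i → D i ⇔ InS α i)
connected-case α s D LR partA onlyPartialSums connected = mk⇔
  (λ lr i → mk⇔ (onlyPartialSums i) λ { (j , j+1<ℓ , i≡) → subst D (sym i≡) (Equivalence.to partA lr j j+1<ℓ (connected j j+1<ℓ)) })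
  (λ descents → Equivalence.from partA λ j j+1<ℓ _ → Equivalence.from (descents _) (j , j+1<ℓ , refl))

blockSum-partialSum : ∀ (αs : List (List ℕ)) m
  → sum (take m (map sum αs)) ≡ sum (take (sum (take m (map length αs))) (concat αs))
blockSum-partialSum αs zero = refl
blockSum-partialSum [] (suc m) = refl
blockSum-partialSum (β ∷ αs) (suc m) = begin
    sum β + sum (take m (map sum αs))                          ≡⟨ cong (sum β +_) (blockSum-partialSum αs m) ⟩
    sum β + sum (take M (concat αs))                           ≡⟨ sym (sum-++ β (take M (concat αs))) ⟩
    sum (β ++ take M (concat αs))                              ≡⟨ cong (λ z → sum (β ++ take z (concat αs))) (sym (m+n∸m≡n (length β) M)) ⟩
    sum (β ++ take ((length β + M) ∸ length β) (concat αs))    ≡⟨ cong sum (sym (take-++-≥ (length β + M) β (concat αs) (m≤m+n _ _))) ⟩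
    sum (take (length β + M) (β ++ concat αs))                 ∎
  where
    open ≡-Reasoning
    M : ℕ
    M = sum (take m (map length αs))

rowBoundary-≤ : ∀ (αs : List (List ℕ)) m → sum (take m (map length αs)) ≤ length (concat αs)
rowBoundary-≤ αs zero = z≤n
rowBoundary-≤ [] (suc m) = z≤n
rowBoundary-≤ (β ∷ αs) (suc m) = subst (length β + sum (take m (map length αs)) ≤_) (sym (length-++ β)) (+-monoʳ-≤ (length β) (rowBoundary-≤ αs m))

blockSum⇔rowBoundary : ∀ α (αs : List (List ℕ)) → concat αs ≡ α → All (0 <_) α
  → ∀ m → m ≤ length α → BlockSums αs (sum (take m α)) ⇔ RowBoundary αs m
blockSum⇔rowBoundary α αs refl positive m m≤ℓ = mk⇔
  (λ (r , r< , e) → r , r< , partialSum-injective α m _ positive m≤ℓ (rowBoundary-≤ αs (suc r)) (trans e (blockSum-partialSum αs (suc r))))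
  (λ (r , r< , e) → r , r< , trans (cong (λ z → sum (take z α)) e) (sym (blockSum-partialSum αs (suc r))))

directSum-case : ∀ (α s : List ℕ) (D : ℕ → Set) (LR : Set) (αs : List (List ℕ)) → concat αs ≡ α → All (0 <_) α
  → (∀ j → suc j < length α → (Overlap α s j ⇔ (¬ RowBoundary αs (suc j))))
  → (LR ⇔ (∀ j → suc j < length α → Overlap α s j → D (sum (take (suc j) α))))
  → LR ⇔ (∀ i → InS α i → ¬ BlockSums αs i → D i)
directSum-case α s D LR αs concat≡ positive overlaps partA = mk⇔
  (λ lr i (j , j+1<ℓ , i≡) notBlock → subst D (sym i≡) (Equivalence.to partA lr j j+1<ℓ
    (Equivalence.from (overlaps j j+1<ℓ) (notBlock ∘ subst (BlockSums αs) (sym i≡) ∘ Equivalence.from (boundary j j+1<ℓ)))))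
  (λ descents → Equivalence.from partA λ j j+1<ℓ o → descents _ (j , j+1<ℓ , refl)
    (Equivalence.to (overlaps j j+1<ℓ) o ∘ Equivalence.to (boundary j j+1<ℓ)))
  where
    boundary : ∀ j → suc j < length α → BlockSums αs (sum (take (suc j) α)) ⇔ RowBoundary αs (suc j)
    boundary j j+1<ℓ = blockSum⇔rowBoundary α αs concat≡ positive (suc j) (<⇒≤ j+1<ℓ)

rowsShrink-partition : ∀ ν G → map length G ≡ ν → Linked _≥_ ν → ∀ r → length (row G (suc r)) ≤ length (row G r)
rowsShrink-partition ν G refl decreasing r rewrite length-row G (suc r) | length-row G r = antitone (map length G) decreasing r
  where
    antitone : ∀ ν → Linked _≥_ ν → ∀ r → ν ! suc r ≤ ν ! r
    antitone [] _ r = z≤n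
    antitone (x ∷ []) _ r = z≤n
    antitone (x ∷ y ∷ ν) (y≤x ∷ _) zero = y≤x
    antitone (x ∷ y ∷ ν) (_ ∷ l) (suc r) = antitone (y ∷ ν) l r

proposition3p10 : (ν α : List ℕ) (G : List (List ℕ)) (s : List ℕ)
    → IsPartition ν → IsComposition α (sum ν) → Tab ν α G → IsRibbon α s
    -- (a)
    → (IsLR α s (phi G α)
        ⇔ (∀ j → suc j < length α → Overlap α s j → Descent (standardize G) (sum (take (suc j) α))))
    -- (b)
    × (Connected α s
        → (IsLR α s (phi G α) ⇔ (∀ i → Descent (standardize G) i ⇔ InS α i)))
    -- (c)
    × ((αs : List (List ℕ)) → concat αs ≡ α → All (λ β → β ≢ []) αs
        → (∀ j → suc j < length α → (Overlap α s j ⇔ (¬ RowBoundary αs (suc j))))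
        → (IsLR α s (phi G α)
            ⇔ (∀ i → InS α i → ¬ BlockSums αs i → Descent (standardize G) i)))
proposition3p10 ν α G s (_ , decreasing) (positive , _) (shape , (rowsSorted , columnsStrict) , bounded , content) ribbon =
  partA ,
  connected-case α s D LR partA descent⇒InS ,
  λ αs concat≡ _ overlaps → directSum-case α s D LR αs concat≡ positive overlaps partA
  where
    open Tableau G α rowsSorted columnsStrict (rowsShrink-partition ν G shape decreasing) bounded content positive
    open OnRibbon s ribbon
    D : ℕ → Set
    D = Descent (standardize G)
    LR : Set
    LR = IsLR α s (phi G α)
    partA : LR ⇔ (∀ j → suc j < length α → Overlap α s j → D (sum (take (suc j) α)))
    partA = LR⇔descents
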